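{- Let $\mathbf u$ be a Sturmian word. Then $nr\mathcal{C}_\mathbf u(n)=n+1$ for every $n\in\mathbb N$.
   Context: A Sturmian word is an infinite word $\mathbf u=u_0u_1\cdots$ over a binary alphabet which has exactly $n+1$ distinct factors of length $n$ for every $n\in\mathbb N$ (equivalently, a recurrent binary word with $n+1$ factors of each length $n$ and exactly one left special and one right special factor of each length). Writing $f_n(i)=u_i\cdots u_{i+n-1}$, the non-repetitive complexity is $nr\mathcal{C}_\mathbf u(n)=\max\{m\in\mathbb N: \exists k\in\mathbb N \text{ such that } f_n(i)\neq f_n(j) \text{ for all } i,j \text{ with } k\le i<j\le k+m-1\}$. -}

module Defs where

open import Data.Nat using (ℕ; _+_; _<_; _≤_; suc)
open import Data.Bool using (Bool)
open import Data.Vec using (Vec; tabulate)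
open import Data.Fin using (Fin; toℕ)
open import Data.List using (List; length)
open import Data.List.Membership.Propositional using (_∈_)
open import Data.List.Relation.Unary.Unique.Propositional using (Unique)
open import Data.Product using (Σ; ∃; _×_)
open import Relation.Binary.PropositionalEquality using (_≡_; _≢_)

Word : Set
Word = ℕ → Bool

factorAt : Word → (n : ℕ) → ℕ → Vec Bool n
factorAt u n i = tabulate (λ (j : Fin n) → u (i + toℕ j))

IsFactor : Word → {n : ℕ} → Vec Bool n → Set
IsFactor u {n} w = ∃ λ i → factorAt u n i ≡ w

FactorCount : Word → ℕ → ℕ → Set
FactorCount u n c =
  Σ (List (Vec Bool n)) λ ws →
    Unique ws × length ws ≡ c ×
    (∀ w → w ∈ ws → IsFactor u w) × (∀ i → factorAt u n i ∈ ws)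

Sturmian : Word → Set
Sturmian u = ∀ n → FactorCount u n (suc n)

DistinctWindow : Word → ℕ → ℕ → ℕ → Set
DistinctWindow u n k m =
  ∀ i j → k ≤ i → i < j → j < k + m → factorAt u n i ≢ factorAt u n j

IsNrC : Word → ℕ → ℕ → Set
IsNrC u n m =
  (∃ λ k → DistinctWindow u n k m) ×
  (∀ m' k → DistinctWindow u n k m' → m' ≤ m)

-- Upper bound: pairwise distinct factors of length n number at most n + 1,
-- since u has only n + 1 factors of that length (distinct-window-bound).
--
-- Lower bound: some window f_n(k), …, f_n(k+n) is pairwise distinct.  We first
-- collect general facts: an eventually periodic word, or one in which from
-- some position on every factor of length k determines the next letter, has
-- boundedly many factors; hence a Sturmian word has a right special factor of
-- every length, which is unique by counting factors of length n and n + 1, and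
-- it is recurrent.  The core (module Core) takes the right special factor R of
-- length n, two consecutive occurrences p < q of R followed by different
-- letters, and shows that the factors strictly after p up to the first repeat
-- of a factor from (p, q] are pairwise distinct yet, by recurrence, include
-- every factor of length n.  This argument only gives the window "not not";
-- since distinctness of a window depends only on the factor of length 2n at
-- its start, a finite search over those factors makes the witness explicit.
module Submission where

open import Defs
open import Data.Nat
open import Data.Nat.Properties
open import Data.Nat.Induction using (<-rec)
open import Data.Nat.Tactic.RingSolver using (solve-∀)
open import Data.Bool using (Bool; true; false) renaming (_≟_ to _≟ᵇ_)
open import Data.Empty using (⊥; ⊥-elim)
open import Data.Fin using (toℕ; fromℕ<)
open import Data.Fin.Properties using (toℕ<n; toℕ-fromℕ<)
open import Data.List using (List; []; _∷_; length; map)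
open import Data.List.Properties using (length-map)
open import Data.List.Membership.Propositional using (_∈_; _∉_)
open import Data.List.Membership.Propositional.Properties using (∈-map⁻)
open import Data.List.Relation.Binary.Subset.Propositional using (_⊆_)
open import Data.List.Relation.Unary.All as All using (All)
open import Data.List.Relation.Unary.AllPairs using (_∷_; [])
open import Data.List.Relation.Unary.Any using (here; there; any?)
open import Data.List.Relation.Unary.Unique.Propositional using (Unique)
import Data.List.Relation.Unary.Unique.Propositional.Properties as Unique
open import Data.List.Relation.Unary.Unique.DecPropositional using (unique?)
open import Data.Product using (∃; ∃₂; _×_; _,_; proj₁; proj₂)
open import Data.Sum using (_⊎_; inj₁; inj₂)
open import Data.Vec using (Vec; _∷ʳ_; lookup) renaming (_∷_ to _∷ᵛ_)
open import Data.Vec.Properties using (lookup∘tabulate; tabulate-cong; ∷ʳ-injective; ∷ʳ-injectiveˡ; ≡-dec)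
open import Relation.Binary.Definitions using (DecidableEquality)
open import Relation.Binary.PropositionalEquality
open import Relation.Nullary using (¬_; Dec; yes; no)
open import Relation.Nullary.Decidable using (_×-dec_; decidable-stable; map′)
open import Relation.Unary using (Decidable)

module _ {A : Set} where
  remove : ∀ {x : A} {ys} → x ∈ ys → List A
  remove {ys = _ ∷ ys} (here _)  = ys
  remove {ys = y ∷ _}  (there p) = y ∷ remove p

  length-remove : ∀ {x : A} {ys} (p : x ∈ ys) → suc (length (remove p)) ≡ length ys
  length-remove (here _)  = refl
  length-remove (there p) = cong suc (length-remove p)

  ∈-remove : ∀ {x y : A} {ys} (p : x ∈ ys) → y ∈ ys → y ≢ x → y ∈ remove p
  ∈-remove (here refl) (here refl) y≢x = ⊥-elim (y≢x refl)
  ∈-remove (here refl) (there q)   _   = q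
  ∈-remove (there p)   (here e)    _   = here e
  ∈-remove (there p)   (there q)   y≢x = there (∈-remove p q y≢x)

  unique-⊆-length : ∀ {xs ys : List A} → Unique xs → xs ⊆ ys → length xs ≤ length ys
  unique-⊆-length {[]}     _             _   = z≤n
  unique-⊆-length {x ∷ xs} (x∉xs ∷ xs!) sub =
    subst (_ ≤_) (length-remove p) (s≤s (unique-⊆-length xs! sub′))
    where
    p = sub (here refl)
    sub′ : xs ⊆ remove p
    sub′ q = ∈-remove p (sub (there q)) (λ y≡x → All.lookup x∉xs q (sym y≡x))

least : ∀ {P : ℕ → Set} → Decidable P → ∀ b → (∃ λ z → z ≤ b × P z) →
        ∃ λ q → q ≤ b × P q × (∀ z → z < q → ¬ P z)
least {P} P? zero    (z , z≤0 , pz) = 0 , z≤n , subst P (n≤0⇒n≡0 z≤0) pz , λ _ ()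
least {P} P? (suc b) (z , z≤1+b , pz) with anyUpTo? P? (suc b)
... | yes (z′ , z′<1+b , pz′) with least P? b (z′ , ≤-pred z′<1+b , pz′)
...   | q , q≤b , pq , minimal = q , m≤n⇒m≤1+n q≤b , pq , minimal
least {P} P? (suc b) (z , z≤1+b , pz) | no none-below with m≤n⇒m<n∨m≡n z≤1+b
... | inj₁ z<1+b = ⊥-elim (none-below (z , z<1+b , pz))
... | inj₂ refl  = z , ≤-refl , pz , λ y y<z py → none-below (y , y<z , py)

first-after : ∀ {P : ℕ → Set} → Decidable P → ∀ {x b} → x < b → P b →
              ∃ λ q → x < q × q ≤ b × P q × (∀ z → x < z → z < q → ¬ P z)
first-after {P} P? {x} {b} x<b pb
  with least (λ z → (x <? z) ×-dec P? z) b (b , ≤-refl , x<b , pb)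
... | q , q≤b , (x<q , pq) , minimal = q , x<q , q≤b , pq , λ z x<z z<q pz → minimal z z<q (x<z , pz)

first-failure : ∀ {P : ℕ → Set} M → P 0 → ¬ P M → ¬ ¬ (∃ λ k → P k × ¬ P (suc k))
first-failure {P} M p0 ¬pM no-failure = holds M ¬pM
  where
  holds : ∀ m → ¬ ¬ P m
  holds zero    ¬p = ¬p p0
  holds (suc m) ¬p = holds m (λ pm → no-failure (m , pm , ¬p))

_∈ᵛ?_ : ∀ {m} (v : Vec Bool m) (vs : List (Vec Bool m)) → Dec (v ∈ vs)
v ∈ᵛ? vs = any? (≡-dec _≟ᵇ_ v) vs

other-letter : ∀ {a b : Bool} c → a ≢ b → c ≡ a ⊎ c ≡ b
other-letter {false} {true}  false _   = inj₁ refl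
other-letter {false} {true}  true  _   = inj₂ refl
other-letter {true}  {false} false _   = inj₂ refl
other-letter {true}  {false} true  _   = inj₁ refl
other-letter {false} {false} _     a≢b = ⊥-elim (a≢b refl)
other-letter {true}  {true}  _     a≢b = ⊥-elim (a≢b refl)

-- Windows of a sequence g : ℕ → A.  window k m lists g k, …, g (k + m - 1), and
-- Distinct k m says these values are pairwise distinct (so DistinctWindow u n
-- is Distinct (factorAt u n)).
module _ {A : Set} (g : ℕ → A) where
  window : ℕ → ℕ → List A
  window k zero    = []
  window k (suc m) = g k ∷ window (suc k) m

  Distinct : ℕ → ℕ → Set
  Distinct k m = ∀ i j → k ≤ i → i < j → j < k + m → g i ≢ g j

  length-window : ∀ k m → length (window k m) ≡ m
  length-window k zero    = refl
  length-window k (suc m) = cong suc (length-window (suc k) m)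

  ∈-window⁺ : ∀ k m {t} → k ≤ t → t < k + m → g t ∈ window k m
  ∈-window⁺ k zero    k≤t t<k+0 = ⊥-elim (<⇒≱ (subst (_ <_) (+-identityʳ k) t<k+0) k≤t)
  ∈-window⁺ k (suc m) {t} k≤t t<k+m with m≤n⇒m<n∨m≡n k≤t
  ... | inj₂ refl = here refl
  ... | inj₁ k<t  = there (∈-window⁺ (suc k) m k<t (subst (t <_) (+-suc k m) t<k+m))

  ∈-window⁻ : ∀ k m {x} → x ∈ window k m → ∃ λ t → k ≤ t × t < k + m × g t ≡ x
  ∈-window⁻ k (suc m) (here refl) = k , ≤-refl , m<m+n k z<s , refl
  ∈-window⁻ k (suc m) (there p) with ∈-window⁻ (suc k) m p
  ... | t , k<t , t<k+m , e = t , <⇒≤ k<t , subst (t <_) (sym (+-suc k m)) t<k+m , e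

  Distinct⇒Unique : ∀ k m → Distinct k m → Unique (window k m)
  Distinct⇒Unique k zero    _ = []
  Distinct⇒Unique k (suc m) d = All.tabulate head-new ∷ Distinct⇒Unique (suc k) m tail-distinct
    where
    head-new : ∀ {x} → x ∈ window (suc k) m → g k ≢ x
    head-new p with ∈-window⁻ (suc k) m p
    ... | t , k<t , t<k+m , refl = d k t ≤-refl k<t (subst (t <_) (sym (+-suc k m)) t<k+m)
    tail-distinct : Distinct (suc k) m
    tail-distinct i j k<i i<j j<k+m = d i j (<⇒≤ k<i) i<j (subst (j <_) (sym (+-suc k m)) j<k+m)

  Unique⇒Distinct : ∀ k m → Unique (window k m) → Distinct k m
  Unique⇒Distinct k zero    _ i j k≤i i<j j<k+0 =
    ⊥-elim (<⇒≱ (subst (_ <_) (+-identityʳ k) j<k+0) (≤-trans k≤i (<⇒≤ i<j)))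
  Unique⇒Distinct k (suc m) (gk∉ ∷ rest!) i j k≤i i<j j<k+m with m≤n⇒m<n∨m≡n k≤i
  ... | inj₂ refl = All.lookup gk∉ (∈-window⁺ (suc k) m i<j (subst (j <_) (+-suc k m) j<k+m))
  ... | inj₁ k<i  = Unique⇒Distinct (suc k) m rest! i j k<i i<j (subst (j <_) (+-suc k m) j<k+m)

  Distinct-shorten : ∀ k {m m′} → m′ ≤ m → Distinct k m → Distinct k m′
  Distinct-shorten k m′≤m d i j k≤i i<j j<k+m′ = d i j k≤i i<j (<-≤-trans j<k+m′ (+-monoʳ-≤ k m′≤m))

  Distinct? : DecidableEquality A → ∀ k m → Dec (Distinct k m)
  Distinct? _≟_ k m = map′ (Unique⇒Distinct k m) (Distinct⇒Unique k m) (unique? _≟_ (window k m))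

  window-cong : ∀ m k k′ → (∀ t → t < m → g (k + t) ≡ g (k′ + t)) → window k m ≡ window k′ m
  window-cong zero    k k′ _ = refl
  window-cong (suc m) k k′ h = cong₂ _∷_
    (subst₂ (λ a b → g a ≡ g b) (+-identityʳ k) (+-identityʳ k′) (h 0 z<s))
    (window-cong m (suc k) (suc k′) λ t t<m →
      subst₂ (λ a b → g a ≡ g b) (+-suc k t) (+-suc k′ t) (h (suc t) (s≤s t<m)))

module _ (u : Word) where
  Agree : ℕ → ℕ → ℕ → Set
  Agree m x y = ∀ t → t < m → u (x + t) ≡ u (y + t)

  factor-≡⇒agree : ∀ {m x y} → factorAt u m x ≡ factorAt u m y → Agree m x y
  factor-≡⇒agree {m} {x} {y} e t t<m =
    subst (λ s → u (x + s) ≡ u (y + s)) (toℕ-fromℕ< t<m) (begin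
      u (x + toℕ j)                    ≡⟨ lookup∘tabulate _ j ⟨
      lookup (factorAt u m x) j        ≡⟨ cong (λ v → lookup v j) e ⟩
      lookup (factorAt u m y) j        ≡⟨ lookup∘tabulate _ j ⟩
      u (y + toℕ j)                    ∎)
    where
    open ≡-Reasoning
    j = fromℕ< t<m

  agree⇒factor-≡ : ∀ {m x y} → Agree m x y → factorAt u m x ≡ factorAt u m y
  agree⇒factor-≡ a = tabulate-cong (λ j → a (toℕ j) (toℕ<n j))

  factor-extend : ∀ {m x y} → factorAt u m x ≡ factorAt u m y → u (x + m) ≡ u (y + m) →
                  factorAt u (suc m) x ≡ factorAt u (suc m) y
  factor-extend {m} {x} {y} e c = agree⇒factor-≡ λ t t<1+m → by-cases (m≤n⇒m<n∨m≡n (≤-pred t<1+m))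
    where
    by-cases : ∀ {t} → t < m ⊎ t ≡ m → u (x + t) ≡ u (y + t)
    by-cases (inj₁ t<m)  = factor-≡⇒agree e _ t<m
    by-cases (inj₂ refl) = c

  factor-split : ∀ {m x y} → factorAt u (suc m) x ≡ factorAt u (suc m) y →
                 factorAt u m x ≡ factorAt u m y × u (x + m) ≡ u (y + m)
  factor-split {m} e =
    agree⇒factor-≡ (λ t t<m → factor-≡⇒agree e t (m<n⇒m<1+n t<m)) , factor-≡⇒agree e m ≤-refl

  factor-inner : ∀ {M x y} m t → factorAt u M x ≡ factorAt u M y → t + m ≤ M →
                 factorAt u m (x + t) ≡ factorAt u m (y + t)
  factor-inner {M} {x} {y} m t e t+m≤M = agree⇒factor-≡ λ s s<m →
    subst₂ (λ a b → u a ≡ u b) (sym (+-assoc x t s)) (sym (+-assoc y t s))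
      (factor-≡⇒agree e (t + s) (<-≤-trans (+-monoʳ-< t s<m) t+m≤M))

  factor-step : ∀ {m x y} → factorAt u m x ≡ factorAt u m y → u (x + m) ≡ u (y + m) →
                factorAt u m (suc x) ≡ factorAt u m (suc y)
  factor-step {m} {x} {y} e c =
    subst₂ (λ a b → factorAt u m a ≡ factorAt u m b) (+-comm x 1) (+-comm y 1)
      (factor-inner m 1 (factor-extend e c) ≤-refl)

  factor-cons : ∀ m i → factorAt u (suc m) i ≡ u i ∷ᵛ factorAt u m (suc i)
  factor-cons m i = cong₂ _∷ᵛ_ (cong u (+-identityʳ i)) (tabulate-cong (λ j → cong u (+-suc i (toℕ j))))

  factor-snoc : ∀ m i → factorAt u (suc m) i ≡ factorAt u m i ∷ʳ u (i + m)
  factor-snoc zero    i = refl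
  factor-snoc (suc m) i = begin
    factorAt u (suc (suc m)) i                       ≡⟨ factor-cons (suc m) i ⟩
    u i ∷ᵛ factorAt u (suc m) (suc i)                ≡⟨ cong (u i ∷ᵛ_) (factor-snoc m (suc i)) ⟩
    u i ∷ᵛ (factorAt u m (suc i) ∷ʳ u (suc i + m))   ≡⟨ cong (λ a → u i ∷ᵛ (factorAt u m (suc i) ∷ʳ u a)) (sym (+-suc i m)) ⟩
    (u i ∷ᵛ factorAt u m (suc i)) ∷ʳ u (i + suc m)   ≡⟨ cong (_∷ʳ u (i + suc m)) (factor-cons m i) ⟨
    factorAt u (suc m) i ∷ʳ u (i + suc m)            ∎
    where open ≡-Reasoning

module _ (u : Word) {m : ℕ} where
  covering-length : ∀ {c} → FactorCount u m c → (ys : List (Vec Bool m)) →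
                    (∀ i → factorAt u m i ∈ ys) → c ≤ length ys
  covering-length (ws , ws! , refl , ws-factors , _) ys covers = unique-⊆-length ws! ws⊆ys
    where
    ws⊆ys : ws ⊆ ys
    ws⊆ys w∈ws with ws-factors _ w∈ws
    ... | i , refl = covers i

  distinct-factors-length : ∀ {c} → FactorCount u m c → (ys : List (Vec Bool m)) → Unique ys →
                            (∀ y → y ∈ ys → IsFactor u y) → length ys ≤ c
  distinct-factors-length (ws , _ , refl , _ , ws-complete) ys ys! factors = unique-⊆-length ys! ys⊆ws
    where
    ys⊆ws : ys ⊆ ws
    ys⊆ws y∈ys with factors _ y∈ys
    ... | i , refl = ws-complete i

  distinct-window-bound : ∀ {c} → FactorCount u m c → ∀ k m′ → Distinct (factorAt u m) k m′ → m′ ≤ c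
  distinct-window-bound {c} count k m′ d =
    subst (_≤ c) (length-window (factorAt u m) k m′)
      (distinct-factors-length count (window (factorAt u m) k m′) (Distinct⇒Unique (factorAt u m) k m′ d)
        (λ _ p → let (t , _ , _ , e) = ∈-window⁻ (factorAt u m) k m′ p in t , e))

EventuallyPeriodic : Word → ℕ → ℕ → Set
EventuallyPeriodic u c d = ∀ y → c ≤ y → u y ≡ u (y + d)

-- An eventually periodic word has at most c + d factors of each length: every
-- factor already occurs before position c + d (move an occurrence d to the left
-- as long as it starts at or after c + d).
module _ (u : Word) {c d : ℕ} (0<d : 0 < d) (periodic : EventuallyPeriodic u c d) where
  early-occurrence : ∀ L x → factorAt u L x ∈ window (factorAt u L) 0 (c + d)
  early-occurrence L = <-rec (λ x → factorAt u L x ∈ window (factorAt u L) 0 (c + d)) occurs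
    where
    period-shift : ∀ y → c ≤ y → factorAt u L y ≡ factorAt u L (y + d)
    period-shift y c≤y = agree⇒factor-≡ u λ t _ →
      trans (periodic (y + t) (≤-trans c≤y (m≤m+n y t))) (cong u (+-comm-middle y t d))
      where
      +-comm-middle : ∀ a b e → a + b + e ≡ a + e + b
      +-comm-middle = solve-∀
    occurs : ∀ x → (∀ {y} → y < x → factorAt u L y ∈ window (factorAt u L) 0 (c + d)) →
             factorAt u L x ∈ window (factorAt u L) 0 (c + d)
    occurs x earlier with x <? c + d
    ... | yes x<c+d = ∈-window⁺ (factorAt u L) 0 (c + d) z≤n x<c+d
    ... | no  x≮c+d = subst (_∈ window (factorAt u L) 0 (c + d)) same-factor (earlier y<x)
      where
      c+d≤x = ≮⇒≥ x≮c+d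
      y = x ∸ d
      d≤x : d ≤ x
      d≤x = ≤-trans (m≤n+m d c) c+d≤x
      same-factor : factorAt u L y ≡ factorAt u L x
      same-factor = trans (period-shift y (subst (_≤ y) (m+n∸n≡m c d) (∸-monoˡ-≤ d c+d≤x)))
                          (cong (factorAt u L) (m∸n+n≡m d≤x))
      y<x : y < x
      y<x = ∸-monoʳ-< 0<d d≤x

  eventually-periodic-complexity : ∀ {L e} → FactorCount u L e → e ≤ c + d
  eventually-periodic-complexity {L} count =
    subst (_ ≤_) (length-window (factorAt u L) 0 (c + d))
      (covering-length u count (window (factorAt u L) 0 (c + d)) (early-occurrence L))

Deterministic : Word → ℕ → ℕ → Set
Deterministic u k s =
  ∀ i j → s ≤ i → s ≤ j → factorAt u k i ≡ factorAt u k j → u (i + k) ≡ u (j + k)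

module _ (u : Word) {k s : ℕ} (det : Deterministic u k s) where
  deterministic-iterate : ∀ {a b} t → s ≤ a → s ≤ b → factorAt u k a ≡ factorAt u k b →
                          factorAt u k (a + t) ≡ factorAt u k (b + t)
  deterministic-iterate {a} {b} zero    _   _   e
    rewrite +-identityʳ a | +-identityʳ b = e
  deterministic-iterate {a} {b} (suc t) s≤a s≤b e
    rewrite +-suc a t | +-suc b t = factor-step u e′ (det (a + t) (b + t) s≤a+t s≤b+t e′)
    where
    e′ = deterministic-iterate t s≤a s≤b e
    s≤a+t = ≤-trans s≤a (m≤m+n a t)
    s≤b+t = ≤-trans s≤b (m≤m+n b t)

  repetition⇒periodic : ∀ {a b} → s ≤ a → a < b → factorAt u k a ≡ factorAt u k b →
                        EventuallyPeriodic u (a + k) (b ∸ a)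
  repetition⇒periodic {a} {b} s≤a a<b e y a+k≤y = begin
    u y                  ≡⟨ cong u y≡a+t+k ⟨
    u (a + t + k)        ≡⟨ det (a + t) (b + t) (≤-trans s≤a (m≤m+n a t)) s≤b+t
                                (deterministic-iterate t s≤a (≤-trans s≤a (<⇒≤ a<b)) e) ⟩
    u (b + t + k)        ≡⟨ cong u b+t+k≡y+d ⟩
    u (y + (b ∸ a))      ∎
    where
    open ≡-Reasoning
    t = y ∸ (a + k)
    s≤b+t = ≤-trans (≤-trans s≤a (<⇒≤ a<b)) (m≤m+n b t)
    y≡a+t+k : a + t + k ≡ y
    y≡a+t+k = trans (swap a t k) (m+[n∸m]≡n a+k≤y)
      where
      swap : ∀ p q r → p + q + r ≡ p + r + q
      swap = solve-∀
    b+t+k≡y+d : b + t + k ≡ y + (b ∸ a)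
    b+t+k≡y+d = begin
      b + t + k                ≡⟨ cong (λ z → z + t + k) (m+[n∸m]≡n (<⇒≤ a<b)) ⟨
      a + (b ∸ a) + t + k      ≡⟨ shuffle a (b ∸ a) t k ⟩
      a + t + k + (b ∸ a)      ≡⟨ cong (_+ (b ∸ a)) y≡a+t+k ⟩
      y + (b ∸ a)              ∎
      where
      shuffle : ∀ p q r s → p + q + r + s ≡ p + r + s + q
      shuffle = solve-∀

-- A Sturmian word is neither eventually periodic (it has c + d + 1 factors of
-- length c + d) nor eventually deterministic for any length k (among the k + 2
-- factors of length k at s, …, s + k + 1 two coincide, making u eventually
-- periodic).
module _ (u : Word) (sturmian : Sturmian u) where
  sturmian-aperiodic : ∀ {c d} → 0 < d → ¬ EventuallyPeriodic u c d
  sturmian-aperiodic {c} {d} 0<d periodic =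
    <-irrefl refl (eventually-periodic-complexity u 0<d periodic (sturmian (c + d)))

  sturmian-not-deterministic : ∀ {k s} → ¬ Deterministic u k s
  sturmian-not-deterministic {k} {s} det =
    <-irrefl refl (distinct-window-bound u (sturmian k) s (suc (suc k)) λ a b s≤a a<b _ e →
      sturmian-aperiodic (m<n⇒0<n∸m a<b) (repetition⇒periodic u det s≤a a<b e))

RightSpecial : Word → ℕ → ℕ → ℕ → Set
RightSpecial u m i j = factorAt u m i ≡ factorAt u m j × u (i + m) ≢ u (j + m)

-- Two distinct ones x, x′ would give the
-- c + 2 distinct factors x1, x′1 and, for each factor w of length m, one
-- extension w·a chosen with a = 0 whenever w0 is a factor.
right-special-unique : ∀ u {m c i j i′ j′} → FactorCount u m c → FactorCount u (suc m) (suc c) →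
                       RightSpecial u m i j → RightSpecial u m i′ j′ → factorAt u m i ≡ factorAt u m i′
right-special-unique u {m} {c} {i} {j} {i′} {j′}
  (ws , ws! , refl , ws-factors , _) (vs , _ , vs-length , _ , vs-complete) rs rs′
  with ≡-dec _≟ᵇ_ (factorAt u m i) (factorAt u m i′)
... | yes same   = same
... | no  x≢x′ = ⊥-elim (<-irrefl refl (subst₂ _≤_ (cong (2 +_) (length-map extension ws)) vs-length
                                          (unique-⊆-length candidates! candidates⊆vs)))
  where
  x  = factorAt u m i
  x′ = factorAt u m i′

  factor-snoc∈ : ∀ p → (factorAt u m p ∷ʳ u (p + m)) ∈ vs
  factor-snoc∈ p = subst (_∈ vs) (factor-snoc u m p) (vs-complete p)

  both-extensions : ∀ {p q} → RightSpecial u m p q → ∀ b → (factorAt u m p ∷ʳ b) ∈ vs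
  both-extensions {p} {q} (same , differ) b with other-letter b differ
  ... | inj₁ refl = factor-snoc∈ p
  ... | inj₂ refl = subst (λ w → (w ∷ʳ b) ∈ vs) (sym same) (factor-snoc∈ q)

  choice : Vec Bool m → Bool
  choice w with (w ∷ʳ false) ∈ᵛ? vs
  ... | yes _ = false
  ... | no  _ = true

  extension : Vec Bool m → Vec Bool (suc m)
  extension w = w ∷ʳ choice w

  extension∈ : ∀ p → extension (factorAt u m p) ∈ vs
  extension∈ p with (factorAt u m p ∷ʳ false) ∈ᵛ? vs
  ... | yes w0∈vs = w0∈vs
  ... | no  w0∉vs with u (p + m) | factor-snoc∈ p
  ...   | false | w0∈vs = ⊥-elim (w0∉vs w0∈vs)
  ...   | true  | w1∈vs = w1∈vs

  choice-false : ∀ w → (w ∷ʳ false) ∈ vs → choice w ≡ false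
  choice-false w w0∈vs with (w ∷ʳ false) ∈ᵛ? vs
  ... | yes _    = refl
  ... | no w0∉vs = ⊥-elim (w0∉vs w0∈vs)

  not-chosen : ∀ w → (w ∷ʳ false) ∈ vs → ∀ w′ → (w ∷ʳ true) ≢ extension w′
  not-chosen w w0∈vs w′ e with ∷ʳ-injective w w′ e
  ... | refl , true≡choice with trans true≡choice (choice-false w w0∈vs)
  ...   | ()

  candidates : List (Vec Bool (suc m))
  candidates = (x ∷ʳ true) ∷ (x′ ∷ʳ true) ∷ map extension ws

  candidates! : Unique candidates
  candidates! =
    ((λ e → x≢x′ (∷ʳ-injectiveˡ x x′ e)) All.∷ new x (both-extensions rs false))
    ∷ (new x′ (both-extensions rs′ false) ∷ Unique.map⁺ (∷ʳ-injectiveˡ _ _) ws!)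
    where
    new : ∀ w → (w ∷ʳ false) ∈ vs → All ((w ∷ʳ true) ≢_) (map extension ws)
    new w w0∈vs = All.tabulate λ v∈ → differs (∈-map⁻ extension v∈)
      where
      differs : ∀ {v} → ∃ (λ w′ → w′ ∈ ws × v ≡ extension w′) → (w ∷ʳ true) ≢ v
      differs (w′ , _ , refl) = not-chosen w w0∈vs w′

  candidates⊆vs : candidates ⊆ vs
  candidates⊆vs (here refl)         = both-extensions rs true
  candidates⊆vs (there (here refl)) = both-extensions rs′ true
  candidates⊆vs (there (there v∈)) with ∈-map⁻ extension v∈
  ... | w , w∈ws , refl with ws-factors w w∈ws
  ...   | p , refl = extension∈ p

PrefixReturns : Word → ℕ → Set
PrefixReturns u k = ∃ λ j → factorAt u k (suc j) ≡ factorAt u k 0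

module _ (u : Word) (sturmian : Sturmian u) where
  -- There is a right special factor of every length: otherwise every factor of
  -- length m would determine its successor letter.
  right-special-exists : ∀ m → ¬ ¬ ∃₂ (RightSpecial u m)
  right-special-exists m none = sturmian-not-deterministic u sturmian det
    where
    det : Deterministic u m 0
    det i j _ _ e with u (i + m) ≟ᵇ u (j + m)
    ... | yes same   = same
    ... | no  differ = ⊥-elim (none (i , j , e , differ))

  -- If the prefix of length k returns but that of length
  -- k + 1 does not, the prefix of length k is right special, hence the only
  -- right special factor of length k.  After position 0 it is never followed by
  -- the letter u k (the longer prefix would return), so from position 1 on every
  -- factor of length k determines its successor, which is impossible.
  prefix-returns : ∀ M → ¬ ¬ PrefixReturns u M
  prefix-returns M ¬returns =
    first-failure {PrefixReturns u} M (0 , refl) ¬returns λ { (k , (j₀ , e₀) , ¬returns′) →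
      sturmian-not-deterministic u sturmian (det k j₀ e₀ ¬returns′) }
    where
    det : ∀ k j₀ → factorAt u k (suc j₀) ≡ factorAt u k 0 → ¬ PrefixReturns u (suc k) →
          Deterministic u k 1
    det k j₀ e₀ ¬returns′ (suc i) (suc j) _ _ e with u (suc i + k) ≟ᵇ u (suc j + k)
    ... | yes same   = same
    ... | no  differ = ⊥-elim (prefix-extends (other-letter (u (0 + k)) differ))
      where
      prefix-special : RightSpecial u k 0 (suc j₀)
      prefix-special = sym e₀ , λ c → ¬returns′ (j₀ , factor-extend u e₀ (sym c))
      prefix-at-i : factorAt u k (suc i) ≡ factorAt u k 0
      prefix-at-i = right-special-unique u (sturmian k) (sturmian (suc k)) (e , differ) prefix-special
      prefix-extends : u (0 + k) ≡ u (suc i + k) ⊎ u (0 + k) ≡ u (suc j + k) → ⊥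
      prefix-extends (inj₁ c) = ¬returns′ (i , factor-extend u prefix-at-i (sym c))
      prefix-extends (inj₂ c) = ¬returns′ (j , factor-extend u (trans (sym e) prefix-at-i) (sym c))

  -- u is recurrent: every factor occurs again after any position b (an
  -- occurrence at j moves forward since the prefix of length j + m returns).
  recurrent : ∀ m i b → ¬ ¬ (∃ λ j → b ≤ j × factorAt u m j ≡ factorAt u m i)
  recurrent m i zero    none = none (i , z≤n , refl)
  recurrent m i (suc b) none =
    recurrent m i b λ { (j , b≤j , e) → prefix-returns (j + m) λ { (j′ , e′) →
      none (suc j′ + j , s≤s (≤-trans b≤j (m≤n+m j j′)) , trans (factor-inner u m j e′ ≤-refl) e) } }

-- Away from occurrences of R the factor at the
-- next position is determined by the current one; at an occurrence of R there
-- are exactly two possible continuations.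
module Core (u : Word) (sturmian : Sturmian u) (n i₀ j₀ : ℕ) (special : RightSpecial u n i₀ j₀) where
  fₙ : ℕ → Vec Bool n
  fₙ = factorAt u n

  R : Vec Bool n
  R = fₙ i₀

  R-free : ℕ → ℕ → Set
  R-free α β = ∀ z → α < z → z < β → fₙ z ≢ R

  R? : Decidable (λ z → fₙ z ≡ R)
  R? z = ≡-dec _≟ᵇ_ (fₙ z) R

  step-away-from-R : ∀ {x y} → fₙ x ≡ fₙ y → fₙ x ≢ R → fₙ (suc x) ≡ fₙ (suc y)
  step-away-from-R {x} {y} e x≢R with u (x + n) ≟ᵇ u (y + n)
  ... | yes same   = factor-step u e same
  ... | no  differ = ⊥-elim (x≢R (right-special-unique u (sturmian n) (sturmian (suc n)) (e , differ) special))

  iterate-away-from-R : ∀ {x y} k → fₙ x ≡ fₙ y → (∀ m → m < k → fₙ (x + m) ≢ R) → fₙ (x + k) ≡ fₙ (y + k)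
  iterate-away-from-R {x} {y} zero e _ rewrite +-identityʳ x | +-identityʳ y = e
  iterate-away-from-R {x} {y} (suc k) e avoid rewrite +-suc x k | +-suc y k =
    step-away-from-R (iterate-away-from-R k e (λ m m<k → avoid m (m<n⇒m<1+n m<k))) (avoid k ≤-refl)

  -- Between two consecutive occurrences α, β of R all factors are distinct:
  -- equal factors at i < j would force an occurrence of R at i + (β - j).
  distinct-before-R : ∀ {α β i j} → α < i → i < j → j ≤ β → fₙ β ≡ R → R-free α β → fₙ i ≢ fₙ j
  distinct-before-R {α} {β} {i} {j} α<i i<j j≤β Rβ free e =
    free (i + k) α<i+k i+k<β (trans (iterate-away-from-R k e avoid) (trans (cong fₙ j+k≡β) Rβ))
    where
    k = β ∸ j
    j+k≡β : j + k ≡ β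
    j+k≡β = m+[n∸m]≡n j≤β
    i+k<β : i + k < β
    i+k<β = subst (i + k <_) j+k≡β (+-monoˡ-< k i<j)
    α<i+k : α < i + k
    α<i+k = <-≤-trans α<i (m≤m+n i k)
    avoid : ∀ m → m < k → fₙ (i + m) ≢ R
    avoid m m<k = free (i + m) (<-≤-trans α<i (m≤m+n i m)) (<-trans (+-monoʳ-< i m<k) i+k<β)

  record SplitPair (p q : ℕ) : Set where
    field
      p<q    : p < q
      R-at-p : fₙ p ≡ R
      R-at-q : fₙ q ≡ R
      free   : R-free p q
      differ : u (p + n) ≢ u (q + n)

  -- If occurrences x < b of R are followed by different letters, then some two
  -- consecutive occurrences in between are.  (Recursion on a bound d ≥ b - x.)
  split-between : ∀ d {x b} → b ≤ x + d → x < b → fₙ x ≡ R → fₙ b ≡ R → u (x + n) ≢ u (b + n) →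
                  ∃₂ SplitPair
  split-between zero    {x} b≤x+0 x<b _ _ _ = ⊥-elim (<⇒≱ x<b (subst (_ ≤_) (+-identityʳ x) b≤x+0))
  split-between (suc d) {x} {b} b≤x+1+d x<b Rx Rb differ with first-after R? x<b Rb
  ... | q , x<q , q≤b , Rq , free with u (x + n) ≟ᵇ u (q + n)
  ...   | no  x≠q = x , q , record { p<q = x<q ; R-at-p = Rx ; R-at-q = Rq ; free = free ; differ = x≠q }
  ...   | yes x=q with m≤n⇒m<n∨m≡n q≤b
  ...     | inj₂ refl = ⊥-elim (differ x=q)
  ...     | inj₁ q<b  = split-between d b≤q+d q<b Rq Rb (λ q=b → differ (trans x=q q=b))
    where
    b≤q+d : b ≤ q + d
    b≤q+d = ≤-trans b≤x+1+d (subst (_≤ q + d) (sym (+-suc x d)) (+-monoˡ-≤ d x<q))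

  -- Let p < q < r be consecutive occurrences of R, where p and q are followed by
  -- different letters, and let t be the first position after q whose factor
  -- already occurs in (p, q]; t ≤ r as f r = f q.  The factors at p+1, …, t-1
  -- are pairwise distinct, and each later factor repeats one of them, since
  -- after every occurrence of R the word continues like after p or after q.
  -- By recurrence they include all n + 1 factors of length n.
  module AfterSplit {p q r} (split : SplitPair p q) (q<r : q < r) (Rr : fₙ r ≡ R) (free-qr : R-free q r) where
    open SplitPair split

    first-cycle : List (Vec Bool n)
    first-cycle = window fₙ (suc p) (q ∸ p)

    1+p+[q∸p]≡1+q : suc p + (q ∸ p) ≡ suc q
    1+p+[q∸p]≡1+q = cong suc (m+[n∸m]≡n (<⇒≤ p<q))

    in-first-cycle : ∀ {y} → p < y → y ≤ q → fₙ y ∈ first-cycle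
    in-first-cycle {y} p<y y≤q = ∈-window⁺ fₙ (suc p) (q ∸ p) p<y (subst (y <_) (sym 1+p+[q∸p]≡1+q) (s≤s y≤q))

    module Cycle {t} (q<t : q < t) (t≤r : t ≤ r) (t-repeats : fₙ t ∈ first-cycle)
                 (t-first : ∀ z → q < z → z < t → fₙ z ∉ first-cycle) where
      p<t : p < t
      p<t = <-trans p<q q<t

      L : ℕ
      L = t ∸ suc p

      1+p+L≡t : suc p + L ≡ t
      1+p+L≡t = m+[n∸m]≡n p<t

      cycle : List (Vec Bool n)
      cycle = window fₙ (suc p) L

      cycle-distinct : Distinct fₙ (suc p) L
      cycle-distinct i j p<i i<j j<1+p+L with j ≤? q | i ≤? q
      ... | yes j≤q | _       = distinct-before-R p<i i<j j≤q R-at-q free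
      ... | no  j≰q | yes i≤q = λ e → t-first j (≰⇒> j≰q) j<t (subst (_∈ first-cycle) e (in-first-cycle p<i i≤q))
        where j<t = subst (j <_) 1+p+L≡t j<1+p+L
      ... | no  j≰q | no  i≰q = distinct-before-R (≰⇒> i≰q) i<j (<⇒≤ (<-≤-trans j<t t≤r)) Rr free-qr
        where j<t = subst (j <_) 1+p+L≡t j<1+p+L

      earlier-occurrence : ∀ {y} → p < y → y ≤ t → ∃ λ y′ → p < y′ × y′ < t × fₙ y ≡ fₙ y′
      earlier-occurrence {y} p<y y≤t with m≤n⇒m<n∨m≡n y≤t
      ... | inj₁ y<t  = y , p<y , y<t , refl
      ... | inj₂ refl with ∈-window⁻ fₙ (suc p) (q ∸ p) t-repeats
      ...   | y′ , p<y′ , y′<1+p+[q∸p] , e =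
        y′ , p<y′ , <-≤-trans (subst (y′ <_) 1+p+[q∸p]≡1+q y′<1+p+[q∸p]) q<t , sym e

      continue : ∀ d {y} → fₙ (suc (suc p + d)) ≡ fₙ y → p < y → y ≤ t →
                 ∃ λ y′ → p < y′ × y′ < t × fₙ (suc p + suc d) ≡ fₙ y′
      continue d e p<y y≤t with earlier-occurrence p<y y≤t
      ... | y′ , p<y′ , y′<t , e′ = y′ , p<y′ , y′<t , trans (cong fₙ (+-suc (suc p) d)) (trans e e′)

      later-in-cycle : ∀ d → ∃ λ y → p < y × y < t × fₙ (suc p + d) ≡ fₙ y
      later-in-cycle zero with earlier-occurrence {suc p} ≤-refl p<t
      ... | y , p<y , y<t , e = y , p<y , y<t , trans (cong fₙ (+-identityʳ (suc p))) e
      later-in-cycle (suc d) with later-in-cycle d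
      ... | y , p<y , y<t , e with R? y
      ...   | no  y≢R = continue d (step-away-from-R e (λ x=R → y≢R (trans (sym e) x=R))) (m<n⇒m<1+n p<y) y<t
      ...   | yes Ry with other-letter (u (suc p + d + n)) differ
      ...     | inj₁ c = continue d (factor-step u (trans e (trans Ry (sym R-at-p))) c) ≤-refl p<t
      ...     | inj₂ c = continue d (factor-step u (trans e (trans Ry (sym R-at-q))) c) (m<n⇒m<1+n p<q) q<t

      -- every factor occurs after p (recurrence), so it lies in the cycle;
      -- membership is decidable, which removes the double negation
      every-factor-in-cycle : ∀ i → fₙ i ∈ cycle
      every-factor-in-cycle i = decidable-stable (fₙ i ∈ᵛ? cycle) λ i∉cycle →
        recurrent u sturmian n i (suc p) λ { (x , p<x , e) → i∉cycle (subst (_∈ cycle) e (in-cycle p<x)) }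
        where
        in-cycle : ∀ {x} → p < x → fₙ x ∈ cycle
        in-cycle {x} p<x with later-in-cycle (x ∸ suc p)
        ... | y , p<y , y<t , e = subst (_∈ cycle) (trans (sym e) (cong fₙ (m+[n∸m]≡n p<x)))
                                    (∈-window⁺ fₙ (suc p) L p<y (subst (y <_) (sym 1+p+L≡t) y<t))

      long-window : Distinct fₙ (suc p) (suc n)
      long-window = Distinct-shorten fₙ (suc p) n+1≤L cycle-distinct
        where
        n+1≤L : suc n ≤ L
        n+1≤L = subst (suc n ≤_) (length-window fₙ (suc p) L)
                  (covering-length u (sturmian n) cycle every-factor-in-cycle)

    window-after-split : ∃ λ k → Distinct fₙ k (suc n)
    window-after-split with first-after (λ z → fₙ z ∈ᵛ? first-cycle) q<r
                              (subst (_∈ first-cycle) (trans R-at-q (sym Rr)) (in-first-cycle p<q ≤-refl))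
    ... | t , q<t , t≤r , t-repeats , t-first = suc p , Cycle.long-window q<t t≤r t-repeats t-first

  -- R occurs at i₀ and, followed by the other letter, at some b > i₀; so two
  -- consecutive occurrences p < q followed by different letters exist, and by
  -- recurrence R occurs once more after q.
  window-exists : ¬ ¬ ∃ λ k → Distinct fₙ k (suc n)
  window-exists none =
    recurrent u sturmian (suc n) j₀ (suc i₀) λ { (b , i₀<b , e) →
      let (same-factor , same-letter) = factor-split u e
          (p , q , split) = split-between b (m≤n+m b i₀) i₀<b refl
                              (trans same-factor (sym (proj₁ special)))
                              (λ c → proj₂ special (trans c same-letter))
      in recurrent u sturmian n i₀ (suc q) λ { (j , q<j , Rj) →
        let (r , q<r , _ , Rr , free-qr) = first-after R? q<j Rj
        in none (AfterSplit.window-after-split split q<r Rr free-qr) } }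

distinct-window-not-not : ∀ u → Sturmian u → ∀ n → ¬ ¬ ∃ λ k → Distinct (factorAt u n) k (suc n)
distinct-window-not-not u sturmian n none =
  right-special-exists u sturmian n λ { (i₀ , j₀ , special) → Core.window-exists u sturmian n i₀ j₀ special none }

distinct-window-invariant : ∀ u {m} w {k k′} → factorAt u (w + m) k ≡ factorAt u (w + m) k′ →
                            Distinct (factorAt u m) k (suc w) → Distinct (factorAt u m) k′ (suc w)
distinct-window-invariant u {m} w {k} {k′} e d =
  Unique⇒Distinct (factorAt u m) k′ (suc w) (subst Unique same-window (Distinct⇒Unique (factorAt u m) k (suc w) d))
  where
  same-window : window (factorAt u m) k (suc w) ≡ window (factorAt u m) k′ (suc w)
  same-window = window-cong (factorAt u m) (suc w) k k′ λ t t<1+w →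
    factor-inner u m t e (+-monoˡ-≤ m (≤-pred t<1+w))

-- A decidable property of positions that only depends on the factor of length L
-- there is decidable for "some position": test one occurrence of each of the
-- finitely many factors of length L.
module _ (u : Word) {L : ℕ} {P : ℕ → Set} (P? : Decidable P)
         (invariant : ∀ {k k′} → factorAt u L k ≡ factorAt u L k′ → P k → P k′) where
  search : (ws : List (Vec Bool L)) → (∀ w → w ∈ ws → IsFactor u w) →
           (∃ P) ⊎ (∀ k → factorAt u L k ∈ ws → ¬ P k)
  search []       _       = inj₂ (λ _ ())
  search (w ∷ ws) factors with factors w (here refl) | search ws (λ v v∈ → factors v (there v∈))
  ... | _       | inj₁ found = inj₁ found
  ... | k₀ , e₀ | inj₂ none with P? k₀
  ...   | yes pk₀ = inj₁ (k₀ , pk₀)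
  ...   | no ¬pk₀ = inj₂ λ { k (here e) pk → ¬pk₀ (invariant (trans e (sym e₀)) pk) ; k (there k∈) → none k k∈ }

  decide-by-factors : ∀ {c} → FactorCount u L c → Dec (∃ P)
  decide-by-factors (ws , _ , _ , ws-factors , ws-complete) with search ws ws-factors
  ... | inj₁ found = yes found
  ... | inj₂ none  = no λ (k , pk) → none k (ws-complete k) pk

-- Hence such a window exists outright: decide it by the factors of length 2n.
distinct-window-exists : ∀ u → Sturmian u → ∀ n → ∃ λ k → Distinct (factorAt u n) k (suc n)
distinct-window-exists u sturmian n
  with decide-by-factors u (λ k → Distinct? (factorAt u n) (≡-dec _≟ᵇ_) k (suc n))
         (distinct-window-invariant u n) (sturmian (n + n))
... | yes found = found
... | no  none  = ⊥-elim (distinct-window-not-not u sturmian n none)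

theorem5 : ∀ u → Sturmian u → ∀ n → IsNrC u n (suc n)
theorem5 u sturmian n = distinct-window-exists u sturmian n , λ m′ k → distinct-window-bound u (sturmian n) k m′
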